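{- Let $\mathbf{A}$ be a normal and quasicomplemented distributive nearlattice and let $F\subseteq A$. Then $F$ is an $\alpha$-filter if and only if $F$ is an $\alpha$-ideal-congruence-kernel, i.e. there exists an $\alpha$-ideal $I$ of $A$ with $F=\ker\theta(I)$.
   Context: A distributive nearlattice is a join-semilattice $\langle A,\vee,1\rangle$ with greatest element $1$ in which every principal filter $[a)=\{x\in A\colon a\le x\}$ is a bounded distributive lattice. A filter of $A$ is a subset containing $1$, upward closed, and closed under those binary meets that exist. An ideal is a non-empty subset that is downward closed and closed under $\vee$. For $a\in A$, $a^{\top}=\{x\in A\colon x\vee a=1\}$ and $a^{\top\top}=\{y\in A\colon y\vee x=1\text{ for all }x\in a^{\top}\}$. A filter $F$ is an $\alpha$-filter if $a^{\top\top}\subseteq F$ for all $a\in F$. An ideal $I$ is an $\alpha$-ideal if for each $a\in A$, $I\cap a^{\top\top}\neq\emptyset$ implies $a\in I$. For an ideal $I$, $\theta(I)=\{(a,b)\in A\times A\colon \exists i\in I\ (a\vee i=b\vee i)\}$ (a congruence of $\mathbf{A}$), and for a congruence $\theta$, $\ker\theta=\{a\in A\colon (a,1)\in\theta\}$. A prime ideal is a proper ideal $P$ with $a\wedge b\in P\Rightarrow a\in P$ or $b\in P$ whenever $a\wedge b$ exists; a maximal ideal is a proper ideal not properly contained in any proper ideal. $\mathbf{A}$ is normal if each prime ideal is contained in a unique maximal ideal; $\mathbf{A}$ is quasicomplemented if for each $a\in A$ there exists $b\in A$ with $a^{\top\top}=b^{\top}$. -}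

module Defs where

open import Level using (0ℓ)
open import Data.Product using (Σ; ∃; _×_; _,_)
open import Data.Sum using (_⊎_)
open import Relation.Nullary using (¬_)
open import Relation.Unary using (Pred; _∈_; _∉_; _⊆_)
open import Relation.Binary.PropositionalEquality using (_≡_)

Subset : Set → Set₁
Subset A = Pred A 0ℓ

_≐_ : {A : Set} → Subset A → Subset A → Set
X ≐ Y = (X ⊆ Y) × (Y ⊆ X)

-- A distributive nearlattice: a join-semilattice ⟨A,∨,1⟩ with greatest
-- element 1 (order x ≤ y iff x ∨ y ≡ y) in which every principal filter
-- [a) = {x | a ≤ x} is a bounded distributive lattice (bounds a and 1;
-- meets taken inside [a), distributive with respect to ∨).
record DistributiveNearlattice : Set₁ where
  infixr 6 _∨_
  infix 4 _≤_
  field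
    Carrier : Set
    _∨_     : Carrier → Carrier → Carrier
    𝟏       : Carrier
    ∨-assoc : ∀ x y z → (x ∨ y) ∨ z ≡ x ∨ (y ∨ z)
    ∨-comm  : ∀ x y → x ∨ y ≡ y ∨ x
    ∨-idem  : ∀ x → x ∨ x ≡ x
    ∨-top   : ∀ x → x ∨ 𝟏 ≡ 𝟏

  _≤_ : Carrier → Carrier → Set
  x ≤ y = x ∨ y ≡ y

  IsMeetIn : Carrier → Carrier → Carrier → Carrier → Set
  IsMeetIn a m x y = (a ≤ m) × (m ≤ x) × (m ≤ y)
                   × (∀ z → a ≤ z → z ≤ x → z ≤ y → z ≤ m)

  field
    meetₐ     : (a x y : Carrier) → a ≤ x → a ≤ y → Carrier
    meetₐ-glb : ∀ a x y (p : a ≤ x) (q : a ≤ y) → IsMeetIn a (meetₐ a x y p q) x y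
    meetₐ-distrib : ∀ a x y z (p : a ≤ x) (q : a ≤ y) (r : a ≤ z)
                      (q∨r : a ≤ y ∨ z) →
                    meetₐ a x (y ∨ z) p q∨r ≡ meetₐ a x y p q ∨ meetₐ a x z p r

module _ (𝐀 : DistributiveNearlattice) where
  open DistributiveNearlattice 𝐀
  private A = Carrier

  IsMeet : A → A → A → Set
  IsMeet m x y = (m ≤ x) × (m ≤ y) × (∀ z → z ≤ x → z ≤ y → z ≤ m)

  record IsFilter (F : Subset A) : Set where
    field
      top∈   : 𝟏 ∈ F
      upward : ∀ {x y} → x ≤ y → x ∈ F → y ∈ F
      meet∈  : ∀ {x y m} → IsMeet m x y → x ∈ F → y ∈ F → m ∈ F

  record IsIdeal (I : Subset A) : Set where
    field
      nonempty : ∃ λ x → x ∈ I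
      downward : ∀ {x y} → x ≤ y → y ∈ I → x ∈ I
      join∈    : ∀ {x y} → x ∈ I → y ∈ I → (x ∨ y) ∈ I

  ⊤[_] : A → Subset A
  ⊤[ a ] x = x ∨ a ≡ 𝟏

  ⊤⊤[_] : A → Subset A
  ⊤⊤[ a ] y = ∀ x → x ∈ ⊤[ a ] → y ∨ x ≡ 𝟏

  record IsαFilter (F : Subset A) : Set where
    field
      filter : IsFilter F
      α      : ∀ {a} → a ∈ F → ⊤⊤[ a ] ⊆ F

  record IsαIdeal (I : Subset A) : Set where
    field
      ideal : IsIdeal I
      α     : ∀ a → (∃ λ x → x ∈ I × x ∈ ⊤⊤[ a ]) → a ∈ I

  θ : Subset A → A → A → Set
  θ I a b = ∃ λ i → i ∈ I × (a ∨ i ≡ b ∨ i)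

  ker : (A → A → Set) → Subset A
  ker R a = R a 𝟏

  IsProper : Subset A → Set
  IsProper I = ∃ λ x → x ∉ I

  record IsPrimeIdeal (P : Subset A) : Set where
    field
      ideal  : IsIdeal P
      proper : IsProper P
      prime  : ∀ {x y m} → IsMeet m x y → m ∈ P → x ∈ P ⊎ y ∈ P

  record IsMaximalIdeal (M : Subset A) : Set₁ where
    field
      ideal   : IsIdeal M
      proper  : IsProper M
      maximal : ∀ (J : Subset A) → IsIdeal J → IsProper J → M ⊆ J → J ⊆ M

  IsNormal : Set₁
  IsNormal = ∀ (P : Subset A) → IsPrimeIdeal P →
               Σ (Subset A) (λ M → IsMaximalIdeal M × P ⊆ M
                 × (∀ (M' : Subset A) → IsMaximalIdeal M' → P ⊆ M' → M' ≐ M))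

  IsQuasicomplemented : Set
  IsQuasicomplemented = ∀ a → ∃ λ b → ⊤⊤[ a ] ≐ ⊤[ b ]

-- For an α-filter F put I = {x | x^⊤ ⊆ F}. Choosing b with a^⊤⊤ = b^⊤ for a ∈ F gives
-- b ∈ I and a ∨ b = 1, so F = ⋃_{i ∈ I} i^⊤ = ker θ(I); I is closed under joins because
-- an element w lying in x^⊤⊤, y^⊤⊤ and (x ∨ y)^⊤ must be 1. Conversely, each a^⊤ is a
-- filter (distributivity of [m) for a meet m), and ker θ(I) = ⋃_{i ∈ I} i^⊤ is a directed
-- union of these, hence a filter, and an α-filter since a ∨ i = 1 means i ∈ a^⊤.
module Submission where

open import Defs hiding (⊤[_]; ⊤⊤[_])
import Defs as D
open import Data.Product using (Σ; ∃; _×_; _,_; proj₁; proj₂)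
open import Relation.Unary using (_∈_; _⊆_)
open import Relation.Binary.PropositionalEquality using (_≡_; sym; trans; cong; subst; module ≡-Reasoning)

module Properties (𝐀 : DistributiveNearlattice) where
  open DistributiveNearlattice 𝐀
  private A = Carrier

  ⊤[_] : A → Subset A
  ⊤[_] = D.⊤[_] 𝐀

  ⊤⊤[_] : A → Subset A
  ⊤⊤[_] = D.⊤⊤[_] 𝐀

  ∨-topˡ : ∀ x → 𝟏 ∨ x ≡ 𝟏
  ∨-topˡ x = trans (∨-comm 𝟏 x) (∨-top x)

  ≤-antisym : ∀ {x y} → x ≤ y → y ≤ x → x ≡ y
  ≤-antisym {x} {y} p q = trans (sym q) (trans (∨-comm y x) p)

  ≤-trans : ∀ {x y z} → x ≤ y → y ≤ z → x ≤ z
  ≤-trans {x} {y} {z} p q = begin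
    x ∨ z        ≡⟨ cong (x ∨_) (sym q) ⟩
    x ∨ (y ∨ z)  ≡⟨ sym (∨-assoc x y z) ⟩
    (x ∨ y) ∨ z  ≡⟨ cong (_∨ z) p ⟩
    y ∨ z        ≡⟨ q ⟩
    z            ∎
    where open ≡-Reasoning

  x≤x∨y : ∀ x y → x ≤ x ∨ y
  x≤x∨y x y = trans (sym (∨-assoc x x y)) (cong (_∨ y) (∨-idem x))

  y≤x∨y : ∀ x y → y ≤ x ∨ y
  y≤x∨y x y = subst (y ≤_) (∨-comm y x) (x≤x∨y y x)

  ∨-lub : ∀ {x y z} → x ≤ z → y ≤ z → x ∨ y ≤ z
  ∨-lub {x} {y} {z} p q = trans (∨-assoc x y z) (trans (cong (x ∨_) q) p)

  meetₐ-unique : ∀ {a m x y} (p : a ≤ x) (q : a ≤ y) → IsMeetIn a m x y → m ≡ meetₐ a x y p q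
  meetₐ-unique {a} {m} {x} {y} p q (a≤m , m≤x , m≤y , m-greatest)
    with meetₐ-glb a x y p q
  ... | (a≤n , n≤x , n≤y , n-greatest) =
    ≤-antisym (n-greatest m a≤m m≤x m≤y) (m-greatest _ a≤n n≤x n≤y)

  meetₐ-isMeet : ∀ {z x y} (p : z ≤ x) (q : z ≤ y) → IsMeet 𝐀 (meetₐ z x y p q) x y
  meetₐ-isMeet {z} {x} {y} p q with meetₐ-glb z x y p q
  ... | (z≤m , m≤x , m≤y , m-greatest) =
    m≤x , m≤y , λ w w≤x w≤y →
      ≤-trans (x≤x∨y w z) (m-greatest (w ∨ z) (y≤x∨y w z) (∨-lub w≤x p) (∨-lub w≤y q))

  ⊤-sym : ∀ {x y} → x ∈ ⊤[ y ] → y ∈ ⊤[ x ]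
  ⊤-sym {x} {y} = trans (∨-comm y x)

  ⊤-mono : ∀ {a b} → a ≤ b → ⊤[ a ] ⊆ ⊤[ b ]
  ⊤-mono {a} {b} a≤b {w} w∨a≡𝟏 = begin
    w ∨ b        ≡⟨ cong (w ∨_) (sym a≤b) ⟩
    w ∨ (a ∨ b)  ≡⟨ sym (∨-assoc w a b) ⟩
    (w ∨ a) ∨ b  ≡⟨ cong (_∨ b) w∨a≡𝟏 ⟩
    𝟏 ∨ b        ≡⟨ ∨-topˡ b ⟩
    𝟏            ∎
    where open ≡-Reasoning

  ⊤-upward : ∀ {a x y} → x ≤ y → x ∈ ⊤[ a ] → y ∈ ⊤[ a ]
  ⊤-upward x≤y x∈ = ⊤-sym (⊤-mono x≤y (⊤-sym x∈))

  -- In [m) one computes y = y ∧ (x ∨ c) = (y ∧ x) ∨ (y ∧ c) = m ∨ (y ∧ c) ≤ c for c = m ∨ k.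
  ⊤-meet∈ : ∀ {k m x y} → IsMeet 𝐀 m x y → x ∈ ⊤[ k ] → y ∈ ⊤[ k ] → m ∈ ⊤[ k ]
  ⊤-meet∈ {k} {m} {x} {y} (m≤x , m≤y , m-greatest) x∈ y∈ =
    trans (sym y≤c) (⊤-mono (y≤x∨y m k) y∈)
    where
    c = m ∨ k
    m≤c = x≤x∨y m k
    x∨c≡𝟏 : x ∨ c ≡ 𝟏
    x∨c≡𝟏 = ⊤-mono (y≤x∨y m k) x∈
    y≤x∨c : y ≤ x ∨ c
    y≤x∨c = subst (y ≤_) (sym x∨c≡𝟏) (∨-top y)
    m≤x∨c = ≤-trans m≤y y≤x∨c
    n = meetₐ m y c m≤y m≤c
    n-glb = meetₐ-glb m y c m≤y m≤c
    y≡n : y ≡ n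
    y≡n = begin
      y                                  ≡⟨ meetₐ-unique m≤y m≤x∨c (m≤y , ∨-idem y , y≤x∨c , λ _ _ z≤y _ → z≤y) ⟩
      meetₐ m y (x ∨ c) m≤y m≤x∨c         ≡⟨ meetₐ-distrib m y x c m≤y m≤x m≤c m≤x∨c ⟩
      meetₐ m y x m≤y m≤x ∨ n             ≡⟨ cong (_∨ n) (sym (meetₐ-unique m≤y m≤x
                                               (∨-idem m , m≤y , m≤x , λ z _ z≤y z≤x → m-greatest z z≤x z≤y))) ⟩
      m ∨ n                              ≡⟨ proj₁ n-glb ⟩
      n                                  ∎
      where open ≡-Reasoning
    y≤c : y ≤ c
    y≤c = subst (_≤ c) (sym y≡n) (proj₁ (proj₂ (proj₂ n-glb)))

  ⊤-isFilter : ∀ k → IsFilter 𝐀 ⊤[ k ]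
  ⊤-isFilter k = record
    { top∈   = ∨-topˡ k
    ; upward = ⊤-upward
    ; meet∈  = ⊤-meet∈ }

  ∈⊤⊤-self : ∀ a → a ∈ ⊤⊤[ a ]
  ∈⊤⊤-self a x x∈ = ⊤-sym x∈

  ⊤⊤⊆⊤ : ∀ {a i} → a ∈ ⊤[ i ] → ⊤⊤[ a ] ⊆ ⊤[ i ]
  ⊤⊤⊆⊤ a∈ y∈ = y∈ _ (⊤-sym a∈)

  ⊤⊤∩⊤≡𝟏 : ∀ {a w} → w ∈ ⊤⊤[ a ] → w ∈ ⊤[ a ] → w ≡ 𝟏
  ⊤⊤∩⊤≡𝟏 {w = w} w∈⊤⊤ w∈⊤ = trans (sym (∨-idem w)) (w∈⊤⊤ w w∈⊤)

  ⊤⊤∩⊤⊤∩⊤-∨≡𝟏 : ∀ {x y w} → w ∈ ⊤⊤[ x ] → w ∈ ⊤⊤[ y ] → w ∈ ⊤[ x ∨ y ] → w ≡ 𝟏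
  ⊤⊤∩⊤⊤∩⊤-∨≡𝟏 {x} {y} {w} w∈⊤⊤x w∈⊤⊤y w∨x∨y≡𝟏 = ⊤⊤∩⊤≡𝟏 w∈⊤⊤y w∈⊤y
    where
    open ≡-Reasoning
    w∨y∈⊤x : w ∨ y ∈ ⊤[ x ]
    w∨y∈⊤x = begin
      (w ∨ y) ∨ x  ≡⟨ ∨-assoc w y x ⟩
      w ∨ (y ∨ x)  ≡⟨ cong (w ∨_) (∨-comm y x) ⟩
      w ∨ (x ∨ y)  ≡⟨ w∨x∨y≡𝟏 ⟩
      𝟏            ∎
    w∈⊤y : w ∈ ⊤[ y ]
    w∈⊤y = begin
      w ∨ y        ≡⟨ cong (_∨ y) (sym (∨-idem w)) ⟩
      (w ∨ w) ∨ y  ≡⟨ ∨-assoc w w y ⟩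
      w ∨ (w ∨ y)  ≡⟨ w∈⊤⊤x (w ∨ y) w∨y∈⊤x ⟩
      𝟏            ∎

  ker-θ-intro : ∀ {I a i} → i ∈ I → a ∈ ⊤[ i ] → a ∈ ker 𝐀 (θ 𝐀 I)
  ker-θ-intro {i = i} i∈I a∨i≡𝟏 = i , i∈I , trans a∨i≡𝟏 (sym (∨-topˡ i))

  ker-θ-elim : ∀ {I a} → a ∈ ker 𝐀 (θ 𝐀 I) → ∃ λ i → i ∈ I × a ∈ ⊤[ i ]
  ker-θ-elim (i , i∈I , a∨i≡𝟏∨i) = i , i∈I , trans a∨i≡𝟏∨i (∨-topˡ i)

  ker-θ-isαFilter : ∀ {I} → IsIdeal 𝐀 I → IsαFilter 𝐀 (ker 𝐀 (θ 𝐀 I))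
  ker-θ-isαFilter {I} I-ideal = record
    { filter = record
      { top∈   = ker-θ-intro (proj₂ nonempty) (IsFilter.top∈ (⊤-isFilter _))
      ; upward = λ x≤y x∈ → let (i , i∈I , x∈⊤i) = ker-θ-elim x∈ in
                   ker-θ-intro i∈I (IsFilter.upward (⊤-isFilter i) x≤y x∈⊤i)
      ; meet∈  = meet∈ }
    ; α = λ a∈ y∈ → let (i , i∈I , a∈⊤i) = ker-θ-elim a∈ in
            ker-θ-intro i∈I (⊤⊤⊆⊤ a∈⊤i y∈) }
    where
    open IsIdeal I-ideal
    meet∈ : ∀ {x y m} → IsMeet 𝐀 m x y →
            x ∈ ker 𝐀 (θ 𝐀 I) → y ∈ ker 𝐀 (θ 𝐀 I) → m ∈ ker 𝐀 (θ 𝐀 I)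
    meet∈ m-meet x∈ y∈ with ker-θ-elim x∈ | ker-θ-elim y∈
    ... | (i , i∈I , x∈⊤i) | (j , j∈I , y∈⊤j) =
      ker-θ-intro (join∈ i∈I j∈I)
        (IsFilter.meet∈ (⊤-isFilter (i ∨ j)) m-meet (⊤-mono (x≤x∨y i j) x∈⊤i) (⊤-mono (y≤x∨y i j) y∈⊤j))

  IsαFilter-resp-≐ : ∀ {F G} → F ≐ G → IsαFilter 𝐀 G → IsαFilter 𝐀 F
  IsαFilter-resp-≐ (F⊆G , G⊆F) G-αFilter = record
    { filter = record
      { top∈   = G⊆F top∈
      ; upward = λ x≤y x∈ → G⊆F (upward x≤y (F⊆G x∈))
      ; meet∈  = λ m-meet x∈ y∈ → G⊆F (meet∈ m-meet (F⊆G x∈) (F⊆G y∈)) }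
    ; α = λ a∈ y∈ → G⊆F (α (F⊆G a∈) y∈) }
    where
    open IsαFilter G-αFilter
    open IsFilter filter

  ⊤-ideal : Subset A → Subset A
  ⊤-ideal F x = ⊤[ x ] ⊆ F

  ⊤-ideal-downward : ∀ {F x y} → x ≤ y → y ∈ ⊤-ideal F → x ∈ ⊤-ideal F
  ⊤-ideal-downward x≤y y∈ z∈ = y∈ (⊤-mono x≤y z∈)

  ⊤-ideal-α : ∀ {F} a → (∃ λ x → x ∈ ⊤-ideal F × x ∈ ⊤⊤[ a ]) → a ∈ ⊤-ideal F
  ⊤-ideal-α a (x , x∈ , x∈⊤⊤a) z∈⊤a = x∈ (⊤-sym (⊤⊤⊆⊤ (⊤-sym z∈⊤a) x∈⊤⊤a))

  ker-θ-⊤-ideal⊆ : ∀ {F} → ker 𝐀 (θ 𝐀 (⊤-ideal F)) ⊆ F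
  ker-θ-⊤-ideal⊆ a∈ = let (i , i∈ , a∈⊤i) = ker-θ-elim a∈ in i∈ a∈⊤i

  module Quasicomplemented (qc : IsQuasicomplemented 𝐀) where

    _* : A → A
    a * = proj₁ (qc a)

    ⊤⊤≐⊤* : ∀ a → ⊤⊤[ a ] ≐ ⊤[ a * ]
    ⊤⊤≐⊤* a = proj₂ (qc a)

    ∈⊤* : ∀ a → a ∈ ⊤[ a * ]
    ∈⊤* a = proj₁ (⊤⊤≐⊤* a) (∈⊤⊤-self a)

    module _ {F : Subset A} (F-αFilter : IsαFilter 𝐀 F) where
      open IsαFilter F-αFilter
      open IsFilter filter

      *∈⊤-ideal : ∀ {a} → a ∈ F → a * ∈ ⊤-ideal F
      *∈⊤-ideal {a} a∈F z∈ = α a∈F (proj₂ (⊤⊤≐⊤* a) z∈)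

      -- z lies in the ⊤⊤ of the meet m of z ∨ x* and z ∨ y*, which belongs to F.
      ⊤-ideal-join∈ : ∀ {x y} → x ∈ ⊤-ideal F → y ∈ ⊤-ideal F → x ∨ y ∈ ⊤-ideal F
      ⊤-ideal-join∈ {x} {y} x∈ y∈ {z} z∈⊤x∨y = α m∈F z∈⊤⊤m
        where
        z≤z∨x* = x≤x∨y z (x *)
        z≤z∨y* = x≤x∨y z (y *)
        m = meetₐ z (z ∨ x *) (z ∨ y *) z≤z∨x* z≤z∨y*
        m-meet = meetₐ-isMeet z≤z∨x* z≤z∨y*
        m∈F : m ∈ F
        m∈F = meet∈ m-meet (upward (y≤x∨y z (x *)) (x∈ (⊤-sym (∈⊤* x))))
                           (upward (y≤x∨y z (y *)) (y∈ (⊤-sym (∈⊤* y))))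
        z∈⊤⊤m : z ∈ ⊤⊤[ m ]
        z∈⊤⊤m t t∈⊤m = ⊤-sym (⊤⊤∩⊤⊤∩⊤-∨≡𝟏 (t∨z∈⊤⊤ x (proj₁ m-meet))
                                          (t∨z∈⊤⊤ y (proj₁ (proj₂ m-meet)))
                                          (⊤-upward (y≤x∨y t z) z∈⊤x∨y))
          where
          t∨z∈⊤⊤ : ∀ u → m ≤ z ∨ u * → t ∨ z ∈ ⊤⊤[ u ]
          t∨z∈⊤⊤ u m≤ = proj₂ (⊤⊤≐⊤* u) (trans (∨-assoc t z (u *)) (⊤-mono m≤ t∈⊤m))

      ⊤-ideal-isαIdeal : IsαIdeal 𝐀 (⊤-ideal F)
      ⊤-ideal-isαIdeal = record
        { ideal = record
          { nonempty = 𝟏 * , *∈⊤-ideal top∈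
          ; downward = ⊤-ideal-downward
          ; join∈    = ⊤-ideal-join∈ }
        ; α = ⊤-ideal-α }

      ≐ker-θ-⊤-ideal : F ≐ ker 𝐀 (θ 𝐀 (⊤-ideal F))
      ≐ker-θ-⊤-ideal = (λ {a} a∈F → ker-θ-intro (λ {z} → *∈⊤-ideal a∈F {z}) (∈⊤* a)) , ker-θ-⊤-ideal⊆

theorem3p15 : (𝐀 : DistributiveNearlattice) → IsNormal 𝐀 → IsQuasicomplemented 𝐀 →
    (F : Subset (DistributiveNearlattice.Carrier 𝐀)) →
    (IsαFilter 𝐀 F → Σ (Subset (DistributiveNearlattice.Carrier 𝐀)) (λ I → IsαIdeal 𝐀 I × F ≐ ker 𝐀 (θ 𝐀 I)))
    × (Σ (Subset (DistributiveNearlattice.Carrier 𝐀)) (λ I → IsαIdeal 𝐀 I × F ≐ ker 𝐀 (θ 𝐀 I)) → IsαFilter 𝐀 F)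
theorem3p15 𝐀 _ qc F =
  (λ F-αFilter → ⊤-ideal F , ⊤-ideal-isαIdeal F-αFilter , ≐ker-θ-⊤-ideal F-αFilter)
  , λ (I , I-αIdeal , F≐ker) →
      IsαFilter-resp-≐ F≐ker (ker-θ-isαFilter (IsαIdeal.ideal I-αIdeal))
  where
  open Properties 𝐀
  open Quasicomplemented qc
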